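{- For $n\ge1$ and every integer $k\ge0$, $$\hat B(n+1,k)=(n+1-k)\big(\hat B(n,k)+\hat B(n,k-2)\big)+k\big(\hat B(n,k+1)+\hat B(n,k-1)\big)+\hat B(n,k+1)+\hat B(n,k-2),$$ where $\hat B(n,k)=0$ for $k<0$ (and for $k>n$), and $\hat B(n,0)=S_n$.
   Context: $\mathcal{B}_n$ is the set of signed permutations of $[n]$ (words $\sigma(1)\cdots\sigma(n)$ with entries in $\{\pm1,\dots,\pm n\}$ whose absolute values form a permutation of $[n]$). Set $\sigma(0)=0$; a position $i\in\{0,\dots,n-1\}$ is a type B alternating descent if either $i$ is even and $\sigma(i)<\sigma(i+1)$, or $i$ is odd and $\sigma(i)>\sigma(i+1)$; $\hat d_B(\sigma)$ is their number. $\hat B(n,k)$ is the number of $\sigma\in\mathcal{B}_n$ with $\hat d_B(\sigma)=k$. $S_n$ is the number of snakes of length $n$, i.e. $\sigma\in\mathcal{B}_n$ with $\sigma(1)>\sigma(2)<\sigma(3)>\cdots$ and $\sigma(1)>0$; their exponential generating function is $1+\sum_{n>0}S_nx^n/n!=1/(\cos x-\sin x)$. -}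

module Defs where

open import Data.Nat as ℕ using (ℕ; zero; suc)
open import Data.Integer as ℤ using (ℤ; +_; -[1+_]; ∣_∣; _<?_)
open import Data.Bool using (Bool; true; false; not; if_then_else_)
open import Data.List using (List; []; _∷_; map; concatMap; filter; length; upTo; _++_)
open import Data.List.Relation.Unary.All using (All; all?)
open import Data.List.Relation.Unary.Unique.DecPropositional ℕ._≟_ using (Unique; unique?)
open import Data.Product using (_×_)
open import Relation.Nullary using (Dec; does)
open import Relation.Nullary.Decidable using (_×-dec_)
open import Relation.Unary using (Decidable)
open import Relation.Binary.PropositionalEquality using (_≡_)

letters : ℕ → List ℤ
letters n = map (λ i → + suc i) (upTo n) ++ map (λ i → -[1+ i ]) (upTo n)

words : {A : Set} → ℕ → List A → List (List A)
words zero    L = [] ∷ []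
words (suc m) L = concatMap (λ x → map (x ∷_) (words m L)) L

-- A word of length n with letters in {±1,…,±n} is a signed permutation of [n]
-- iff its absolute values are pairwise distinct (then they form a permutation of [n]).
IsSignedPerm : List ℤ → Set
IsSignedPerm w = Unique (map ∣_∣ w)

isSignedPerm? : Decidable IsSignedPerm
isSignedPerm? w = unique? (map ∣_∣ w)

signedPerms : ℕ → List (List ℤ)
signedPerms n = filter isSignedPerm? (words n (letters n))

-- Counting type B alternating descents of σ(0)σ(1)⋯σ(n) with σ(0) = 0.
-- 'even' records the parity of the current position i; 'p' is σ(i);
-- the list is σ(i+1)⋯σ(n).
altDesB-go : Bool → ℤ → List ℤ → ℕ
altDesB-go even p []       = 0
altDesB-go even p (x ∷ xs) =
  (if (if even then does (p <? x) else does (x <? p)) then 1 else 0)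
  ℕ.+ altDesB-go (not even) x xs

altDesB : List ℤ → ℕ
altDesB σ = altDesB-go true (+ 0) σ

Bhat : ℕ → ℕ → ℕ
Bhat n k = length (filter (λ σ → altDesB σ ℕ.≟ k) (signedPerms n))

-- B̂(n,k) for integer k, with B̂(n,k) = 0 for k < 0.
-- (For k > n it is automatically 0, since d̂_B(σ) ≤ n.)
BhatZ : ℕ → ℤ → ℤ
BhatZ n (+ k)    = + Bhat n k
BhatZ n -[1+ _ ] = + 0

module Submission where

-- Every signed permutation of [n+1] arises from exactly one σ ∈ 𝓑_n by splitting σ = a b and
-- writing a, ±(n+1), −b.  Negating b and shifting it by one position flips both the parity and
-- every comparison, so all alternating descents inside b survive.  The comparison between the
-- last letter of a and the first of b is replaced by a peak at n+1 or a valley at −(n+1): one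
-- sign gives two alternating descents there and the other none; at the end of the word the two
-- signs give one and none.  So if d̂_B(σ) = m, its 2(n+1) extensions have m descents n+1−m
-- times, m+2 descents n−m times, m−1 descents m times and m+1 descents m+1 times; summing
-- over σ ∈ 𝓑_n and evaluating these coefficients at the target count k gives the recurrence.

open import Defs
open import Data.Bool using (Bool; true; false; not; if_then_else_)
open import Data.Nat as ℕ using (ℕ; zero; suc; _≤_; _<_; s≤s; z≤n)
import Data.Nat.Properties as ℕ
open import Data.Integer as ℤ using (ℤ; +_; -[1+_]; -_; ∣_∣; _<?_; _+_; _-_; _*_)
import Data.Integer.Properties as ℤ
open import Data.Integer.Tactic.RingSolver using (solve-∀)
open import Data.List using (List; []; _∷_; _++_; map; concatMap; filter; length; upTo; applyUpTo)
import Data.List.Properties as List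
open import Data.List.Membership.Propositional using (_∈_; _∉_; find; lose)
open import Data.List.Membership.Propositional.Properties
  using (∈-++⁻; ∈-++⁺ˡ; ∈-++⁺ʳ; ∈-map⁻; ∈-map⁺; ∈-upTo⁻; ∈-upTo⁺; ∈-applyUpTo⁺;
         ∈-∃++; ∈-concatMap⁻; ∈-concatMap⁺; ∈-filter⁻; ∈-filter⁺)
open import Data.List.Membership.Propositional.Properties.WithK using (unique∧set⇒bag)
open import Data.List.Relation.Unary.All as All using (All; []; _∷_)
import Data.List.Relation.Unary.All.Properties as All
open import Data.List.Relation.Unary.Any using (here; there; any?)
open import Data.List.Relation.Unary.AllPairs using ([]; _∷_)
open import Data.List.Relation.Unary.Unique.Propositional using (Unique)
import Data.List.Relation.Unary.Unique.Propositional.Properties as Unique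
open import Data.List.Relation.Binary.BagAndSetEquality using (∼bag⇒↭)
open import Data.List.Relation.Binary.Permutation.Propositional
  using (_↭_; refl; prep; swap; trans; ↭-sym; ↭⇒↭ₛ)
open import Data.List.Relation.Binary.Permutation.Propositional.Properties
  using (shift; ↭-length; ∈-resp-↭)
import Data.List.Relation.Binary.Permutation.Setoid.Properties as Permutationₛ
open import Data.Product as Product using (_×_; _,_; proj₁; proj₂; ∃; ∃₂)
open import Data.Sum using (inj₁; inj₂)
open import Function using (_∘_)
open import Function.Bundles using (mk⇔)
open import Relation.Nullary using (¬_; Dec; does; yes; no; contradiction)
open import Relation.Nullary.Decidable using (does-⇔; dec-true; dec-false)
open import Relation.Binary.PropositionalEquality as ≡
  using (_≡_; _≢_; refl; sym; cong; cong₂; module ≡-Reasoning)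

private variable
  A B : Set

∑ : {A : Set} → List A → (A → ℤ) → ℤ
∑ []       f = + 0
∑ (x ∷ xs) f = f x + ∑ xs f

infix 5 ∑
syntax ∑ xs (λ x → e) = ∑[ x ← xs ] e

∑-++ : ∀ (xs ys : List A) f → ∑ (xs ++ ys) f ≡ ∑ xs f + ∑ ys f
∑-++ []       ys f = sym (ℤ.+-identityˡ (∑ ys f))
∑-++ (x ∷ xs) ys f rewrite ∑-++ xs ys f = sym (ℤ.+-assoc (f x) (∑ xs f) (∑ ys f))

∑-concatMap : ∀ (g : A → List B) xs f →
              ∑ (concatMap g xs) f ≡ ∑[ x ← xs ] ∑ (g x) f
∑-concatMap g []       f = refl
∑-concatMap g (x ∷ xs) f rewrite ∑-++ (g x) (concatMap g xs) f | ∑-concatMap g xs f = refl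

∑-map : ∀ (g : A → B) xs f → ∑ (map g xs) f ≡ ∑[ x ← xs ] f (g x)
∑-map g []       f = refl
∑-map g (x ∷ xs) f = cong (λ s → f (g x) + s) (∑-map g xs f)

∑-cong : ∀ (xs : List A) {f g} → (∀ {x} → x ∈ xs → f x ≡ g x) → ∑ xs f ≡ ∑ xs g
∑-cong []       f≗g = refl
∑-cong (x ∷ xs) f≗g = cong₂ _+_ (f≗g (here refl)) (∑-cong xs (λ x∈ → f≗g (there x∈)))

∑-↭ : ∀ {xs ys : List A} f → xs ↭ ys → ∑ xs f ≡ ∑ ys f
∑-↭ f refl        = refl
∑-↭ f (prep x p)  = cong (λ s → f x + s) (∑-↭ f p)
∑-↭ f (swap x y p) rewrite ∑-↭ f p = +-exchange (f x) (f y) _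
  where
  +-exchange : ∀ a b c → a + (b + c) ≡ b + (a + c)
  +-exchange = solve-∀
∑-↭ f (trans p q) rewrite ∑-↭ f p = ∑-↭ f q

∑-zero : ∀ (xs : List A) → ∑[ x ← xs ] + 0 ≡ + 0
∑-zero []       = refl
∑-zero (x ∷ xs) = ≡.trans (ℤ.+-identityˡ _) (∑-zero xs)

-- Counting with a Kronecker delta
δ : ℕ → ℤ → ℤ
δ m (+ j)    = if does (m ℕ.≟ j) then + 1 else + 0
δ m -[1+ _ ] = + 0

δ-suc : ∀ m z → δ (suc m) z ≡ δ m (z - + 1)
δ-suc m (+ zero)  = refl
δ-suc m (+ suc j) = refl
δ-suc m -[1+ j ]  = refl

δ-shift : ∀ a m z → δ (a ℕ.+ m) z ≡ δ m (z - + a)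
δ-shift zero    m z = cong (δ m) (sym (ℤ.+-identityʳ z))
δ-shift (suc a) m z = begin
  δ (suc (a ℕ.+ m)) z    ≡⟨ δ-suc (a ℕ.+ m) z ⟩
  δ (a ℕ.+ m) (z - + 1)  ≡⟨ δ-shift a m (z - + 1) ⟩
  δ m (z - + 1 - + a)    ≡⟨ cong (δ m) (sub-sub z (+ a)) ⟩
  δ m (z - + suc a)      ∎
  where
  open ≡-Reasoning
  sub-sub : ∀ z a → z - + 1 - a ≡ z - (+ 1 + a)
  sub-sub = solve-∀

δ-vanish : ∀ m z → (+ m - z) * δ m z ≡ + 0
δ-vanish m (+ j)    = vanish (m ℕ.≟ j)
  where
  vanish : (m≟j : Dec (m ≡ j)) → (+ m - + j) * (if does m≟j then + 1 else + 0) ≡ + 0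
  vanish (yes refl) = cong (_* + 1) (ℤ.+-inverseʳ (+ m))
  vanish (no _)     = ℤ.*-zeroʳ (+ m - + j)
δ-vanish m -[1+ j ] = ℤ.*-zeroʳ (+ m - -[1+ j ])

length-filter≡∑δ : ∀ (f : A → ℕ) k xs →
                   + length (filter (λ x → f x ℕ.≟ k) xs) ≡ ∑[ x ← xs ] δ (f x) (+ k)
length-filter≡∑δ f k []       = refl
-- Both the filter test does (f x ℕ.≟ k) and δ (f x) (+ k) compute to a test of f x ℕ.≡ᵇ k.
length-filter≡∑δ f k (x ∷ xs) with f x ℕ.≡ᵇ k
... | true  = cong (λ s → + 1 + s) (length-filter≡∑δ f k xs)
... | false = ≡.trans (length-filter≡∑δ f k xs) (sym (ℤ.+-identityˡ _))

BhatZ≡∑δ : ∀ n z → BhatZ n z ≡ ∑[ σ ← signedPerms n ] δ (altDesB σ) z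
BhatZ≡∑δ n (+ k)    = length-filter≡∑δ altDesB k (signedPerms n)
BhatZ≡∑δ n -[1+ _ ] = sym (∑-zero (signedPerms n))

nextRow : ℕ → (ℤ → ℤ) → ℤ → ℤ
nextRow n B z = ((+ suc n - z) * (B z + B (z - + 2)))
                + (z * (B (z + + 1) + B (z - + 1)))
                + B (z + + 1) + B (z - + 2)

nextRow-+ : ∀ n f g z → nextRow n f z + nextRow n g z ≡ nextRow n (λ w → f w + g w) z
nextRow-+ n f g z =
  additive (+ suc n - z) z (f z) (f (z - + 2)) (f (z + + 1)) (f (z - + 1))
                           (g z) (g (z - + 2)) (g (z + + 1)) (g (z - + 1))
  where
  additive : ∀ c z f₀ f₂ f₁ f₃ g₀ g₂ g₁ g₃ →
    (c * (f₀ + f₂) + z * (f₁ + f₃) + f₁ + f₂) + (c * (g₀ + g₂) + z * (g₁ + g₃) + g₁ + g₂)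
    ≡ c * ((f₀ + g₀) + (f₂ + g₂)) + z * ((f₁ + g₁) + (f₃ + g₃)) + (f₁ + g₁) + (f₂ + g₂)
  additive = solve-∀

nextRow-cong : ∀ n {f g} → (∀ w → f w ≡ g w) → ∀ z → nextRow n f z ≡ nextRow n g z
nextRow-cong n f≗g z
  rewrite f≗g z | f≗g (z - + 2) | f≗g (z + + 1) | f≗g (z - + 1) = refl

∑-nextRow : ∀ n (xs : List A) (B : A → ℤ → ℤ) z →
            ∑[ x ← xs ] nextRow n (B x) z ≡ nextRow n (λ w → ∑[ x ← xs ] B x w) z
∑-nextRow n []       B z = vanishing (+ suc n - z) z
  where
  vanishing : ∀ c z → + 0 ≡ c * (+ 0 + + 0) + z * (+ 0 + + 0) + + 0 + + 0
  vanishing = solve-∀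
∑-nextRow n (x ∷ xs) B z =
  ≡.trans (cong (λ s → nextRow n (B x) z + s) (∑-nextRow n xs B z))
          (nextRow-+ n (B x) (λ w → ∑[ y ← xs ] B y w) z)

does-neg-<? : ∀ a b → does (- a <? - b) ≡ does (b <? a)
does-neg-<? a b = does-⇔ (mk⇔ ℤ.neg-cancel-< ℤ.neg-mono-<) (- a <? - b) (b <? a)

altDesB-go-neg : ∀ e p xs → altDesB-go e (- p) (map -_ xs) ≡ altDesB-go (not e) p xs
altDesB-go-neg e     p []       = refl
altDesB-go-neg true  p (x ∷ xs) =
  cong₂ (λ b r → (if b then 1 else 0) ℕ.+ r) (does-neg-<? p x) (altDesB-go-neg false x xs)
altDesB-go-neg false p (x ∷ xs) =
  cong₂ (λ b r → (if b then 1 else 0) ℕ.+ r) (does-neg-<? x p) (altDesB-go-neg true x xs)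

module _ {p X : ℤ} where

  altDesB-go-max : ∀ e → p ℤ.< X → altDesB-go e p (X ∷ []) ≡ (if e then 1 else 0)
  altDesB-go-max true  p<X rewrite dec-true  (p <? X) p<X             = refl
  altDesB-go-max false p<X rewrite dec-false (X <? p) (ℤ.<-asym p<X) = refl

  altDesB-go-min : ∀ e → X ℤ.< p → altDesB-go e p (X ∷ []) ≡ (if e then 0 else 1)
  altDesB-go-min true  X<p rewrite dec-false (p <? X) (ℤ.<-asym X<p) = refl
  altDesB-go-min false X<p rewrite dec-true  (X <? p) X<p             = refl

  altDesB-go-peak : ∀ e {y ys} → p ℤ.< X → y ℤ.< X →
                    altDesB-go e p (X ∷ y ∷ ys) ≡ (if e then 2 else 0) ℕ.+ altDesB-go e y ys
  altDesB-go-peak true  {y} p<X y<X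
    rewrite dec-true (p <? X) p<X | dec-true (y <? X) y<X = refl
  altDesB-go-peak false {y} p<X y<X
    rewrite dec-false (X <? p) (ℤ.<-asym p<X) | dec-false (X <? y) (ℤ.<-asym y<X) = refl

  altDesB-go-valley : ∀ e {y ys} → X ℤ.< p → X ℤ.< y →
                      altDesB-go e p (X ∷ y ∷ ys) ≡ (if e then 0 else 2) ℕ.+ altDesB-go e y ys
  altDesB-go-valley true  {y} X<p X<y
    rewrite dec-false (p <? X) (ℤ.<-asym X<p) | dec-false (y <? X) (ℤ.<-asym X<y) = refl
  altDesB-go-valley false {y} X<p X<y
    rewrite dec-true (X <? p) X<p | dec-true (X <? y) X<y = refl

<-top : ∀ {n} y → ∣ y ∣ ≤ n → y ℤ.< + suc n
<-top (+ _)      y≤n = ℤ.+<+ (s≤s y≤n)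
<-top -[1+ _ ]   _   = ℤ.-<+

bottom-< : ∀ {n} y → ∣ y ∣ ≤ n → -[1+ n ] ℤ.< y
bottom-< (+ _)      _   = ℤ.-<+
bottom-< -[1+ _ ]   y≤n = ℤ.-<- y≤n

∣-y∣≤n : ∀ {n} y → ∣ y ∣ ≤ n → ∣ - y ∣ ≤ n
∣-y∣≤n {n} y = ≡.subst (_≤ n) (sym (ℤ.∣-i∣≡∣i∣ y))

-- Descents of the extensions of a word
insertions : ℤ → List ℤ → List (List ℤ)
insertions X []       = (X ∷ []) ∷ []
insertions X (x ∷ xs) = (X ∷ map -_ (x ∷ xs)) ∷ map (x ∷_) (insertions X xs)

extensions : ℕ → List ℤ → List (List ℤ)
extensions n σ = insertions (+ suc n) σ ++ insertions -[1+ n ] σ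

descends : Bool → ℤ → ℤ → Bool
descends e p x = if e then does (p <? x) else does (x <? p)

∑-insertions-∷ : ∀ X e p x xs z →
  ∑[ w ← insertions X (x ∷ xs) ] δ (altDesB-go e p w) z
  ≡ δ (altDesB-go e p (X ∷ map -_ (x ∷ xs))) z
    + (∑[ w ← insertions X xs ]
         δ (altDesB-go (not e) x w) (z - + (if descends e p x then 1 else 0)))
∑-insertions-∷ X e p x xs z =
  cong (λ s → δ (altDesB-go e p (X ∷ map -_ (x ∷ xs))) z + s) (begin
  ∑[ w ← map (x ∷_) (insertions X xs) ] δ (altDesB-go e p w) z
    ≡⟨ ∑-map (x ∷_) (insertions X xs) _ ⟩
  ∑[ w ← insertions X xs ] δ ((if descends e p x then 1 else 0) ℕ.+ altDesB-go (not e) x w) z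
    ≡⟨ ∑-cong (insertions X xs) (λ {w} _ → δ-shift _ (altDesB-go (not e) x w) z) ⟩
  ∑[ w ← insertions X xs ] δ (altDesB-go (not e) x w) (z - + (if descends e p x then 1 else 0)) ∎)
  where open ≡-Reasoning

-- δ m (z - + j) tests z = m + j: the multiplicities of m, m + 2, m − 1 and m + 1 descents.
offspring : ℕ → ℕ → ℤ → ℤ
offspring m L z = (+ suc L - + m) * δ m z + (+ L - + m) * δ m (z - + 2)
                  + + m * δ m (z + + 1) + + suc m * δ m (z - + 1)

private
  sub-add : ∀ z → z - + 1 + + 1 ≡ z
  sub-add = solve-∀
  add-sub : ∀ z → z + + 1 - + 1 ≡ z
  add-sub = solve-∀
  sub-sub : ∀ z → z - + 1 - + 1 ≡ z - + 2
  sub-sub = solve-∀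
  sub-sub-comm : ∀ z → z - + 2 - + 1 ≡ z - + 1 - + 2
  sub-sub-comm = solve-∀

offspring-at-pred : ∀ m L z → offspring m L (z - + 1)
  ≡ (+ suc L - + m) * δ m (z - + 1) + (+ L - + m) * δ m (z - + 1 - + 2)
    + + m * δ m z + + suc m * δ m (z - + 2)
offspring-at-pred m L z =
  cong₂ (λ u v → (+ suc L - + m) * δ m (z - + 1) + (+ L - + m) * δ m (z - + 1 - + 2)
                 + + m * u + + suc m * v)
        (cong (δ m) (sub-add z)) (cong (δ m) (sub-sub z))

offspring-suc : ∀ m L z → offspring (suc m) L z
  ≡ (+ suc L - + suc m) * δ m (z - + 1) + (+ L - + suc m) * δ m (z - + 1 - + 2)
    + + suc m * δ m z + + suc (suc m) * δ m (z - + 2)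
offspring-suc m L z =
  cong₂ _+_ (cong₂ _+_ (cong₂ _+_ (cong ((+ suc L - + suc m) *_) (δ-suc m z))
                                  (cong ((+ L - + suc m) *_) (shifted (z - + 2) (sub-sub-comm z))))
                       (cong (+ suc m *_) (shifted (z + + 1) (add-sub z))))
            (cong (+ suc (suc m) *_) (shifted (z - + 1) (sub-sub z)))
  where
  shifted : ∀ w {v} → w - + 1 ≡ v → δ (suc m) w ≡ δ m v
  shifted w eq = ≡.trans (δ-suc m w) (cong (δ m) eq)

offspring-step : ∀ b m L z →
  δ m z + δ m (z - + 2) + offspring m L (z - + (if b then 1 else 0))
  ≡ offspring ((if b then 1 else 0) ℕ.+ m) (suc L) z
offspring-step false m L z =
  ≡.trans (cong (λ w → δ m z + δ m (z - + 2) + offspring m L w) (ℤ.+-identityʳ z))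
          (grow (+ L) (+ m) (δ m z) (δ m (z - + 2)) (δ m (z + + 1)) (δ m (z - + 1)))
  where
  grow : ∀ L m a₀ a₂ a₁ a₃ →
    a₀ + a₂ + ((+ 1 + L - m) * a₀ + (L - m) * a₂ + m * a₁ + (+ 1 + m) * a₃)
    ≡ (+ 1 + (+ 1 + L) - m) * a₀ + (+ 1 + L - m) * a₂ + m * a₁ + (+ 1 + m) * a₃
  grow = solve-∀
offspring-step true m L z = begin
  δ m z + δ m (z - + 2) + offspring m L (z - + 1)
    ≡⟨ cong (λ s → δ m z + δ m (z - + 2) + s) (offspring-at-pred m L z) ⟩
  δ m z + δ m (z - + 2) + ((+ suc L - + m) * δ m (z - + 1)
    + (+ L - + m) * δ m (z - + 1 - + 2) + + m * δ m z + + suc m * δ m (z - + 2))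
    ≡⟨ grow (+ L) (+ m) (δ m z) (δ m (z - + 2)) (δ m (z - + 1)) (δ m (z - + 1 - + 2)) ⟩
  (+ suc (suc L) - + suc m) * δ m (z - + 1) + (+ suc L - + suc m) * δ m (z - + 1 - + 2)
    + + suc m * δ m z + + suc (suc m) * δ m (z - + 2)
    ≡⟨ sym (offspring-suc m (suc L) z) ⟩
  offspring (suc m) (suc L) z ∎
  where
  open ≡-Reasoning
  grow : ∀ L m a₀ a₂ a₁ a₃ →
    a₀ + a₂ + ((+ 1 + L - m) * a₁ + (L - m) * a₃ + m * a₀ + (+ 1 + m) * a₂)
    ≡ (+ 1 + (+ 1 + L) - (+ 1 + m)) * a₁ + (+ 1 + L - (+ 1 + m)) * a₃
      + (+ 1 + m) * a₀ + (+ 1 + (+ 1 + m)) * a₂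
  grow = solve-∀

δ-peak+valley : ∀ n e p x xs z → ∣ p ∣ ≤ n → ∣ x ∣ ≤ n →
  δ (altDesB-go e p (+ suc n ∷ map -_ (x ∷ xs))) z
  + δ (altDesB-go e p (-[1+ n ] ∷ map -_ (x ∷ xs))) z
  ≡ δ (altDesB-go (not e) x xs) z + δ (altDesB-go (not e) x xs) (z - + 2)
δ-peak+valley n e p x xs z p≤n x≤n =
  ≡.trans (cong₂ (λ a b → δ a z + δ b z) peak valley) (pair e (altDesB-go (not e) x xs))
  where
  neg-x≤n : ∣ - x ∣ ≤ n
  neg-x≤n = ∣-y∣≤n x x≤n
  tail : altDesB-go e (- x) (map -_ xs) ≡ altDesB-go (not e) x xs
  tail = altDesB-go-neg e x xs
  peak : altDesB-go e p (+ suc n ∷ map -_ (x ∷ xs)) ≡ (if e then 2 else 0) ℕ.+ altDesB-go (not e) x xs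
  peak = ≡.trans (altDesB-go-peak e {ys = map -_ xs} (<-top p p≤n) (<-top (- x) neg-x≤n))
                 (cong ((if e then 2 else 0) ℕ.+_) tail)
  valley : altDesB-go e p (-[1+ n ] ∷ map -_ (x ∷ xs)) ≡ (if e then 0 else 2) ℕ.+ altDesB-go (not e) x xs
  valley = ≡.trans (altDesB-go-valley e {ys = map -_ xs} (bottom-< p p≤n) (bottom-< (- x) neg-x≤n))
                   (cong ((if e then 0 else 2) ℕ.+_) tail)
  pair : ∀ e m → δ ((if e then 2 else 0) ℕ.+ m) z + δ ((if e then 0 else 2) ℕ.+ m) z
                 ≡ δ m z + δ m (z - + 2)
  pair true  m = ≡.trans (ℤ.+-comm (δ (2 ℕ.+ m) z) (δ m z))
                         (cong (λ s → δ m z + s) (δ-shift 2 m z))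
  pair false m = cong (λ s → δ m z + s) (δ-shift 2 m z)

∑-insertions± : ∀ n e p xs z → ∣ p ∣ ≤ n → All (λ x → ∣ x ∣ ≤ n) xs →
  (∑[ w ← insertions (+ suc n) xs ] δ (altDesB-go e p w) z)
  + (∑[ w ← insertions -[1+ n ] xs ] δ (altDesB-go e p w) z)
  ≡ offspring (altDesB-go e p xs) (length xs) z
∑-insertions± n e p [] z p≤n [] =
  ≡.trans (cong₂ (λ a b → δ a z + + 0 + (δ b z + + 0))
                 (altDesB-go-max e (<-top p p≤n)) (altDesB-go-min e (bottom-< p p≤n)))
          (ends e)
  where
  ends : ∀ e → δ (if e then 1 else 0) z + + 0 + (δ (if e then 0 else 1) z + + 0)
               ≡ offspring 0 0 z
  ends true  = ≡.trans (cong (λ a → a + + 0 + (δ 0 z + + 0)) (δ-suc 0 z))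
                       (swapped (δ 0 z) (δ 0 (z - + 1)) (δ 0 (z - + 2)) (δ 0 (z + + 1)))
    where
    swapped : ∀ a b c d →
              b + + 0 + (a + + 0) ≡ (+ 1 - + 0) * a + (+ 0 - + 0) * c + + 0 * d + + 1 * b
    swapped = solve-∀
  ends false = ≡.trans (cong (λ b → δ 0 z + + 0 + (b + + 0)) (δ-suc 0 z))
                       (ordered (δ 0 z) (δ 0 (z - + 1)) (δ 0 (z - + 2)) (δ 0 (z + + 1)))
    where
    ordered : ∀ a b c d →
              a + + 0 + (b + + 0) ≡ (+ 1 - + 0) * a + (+ 0 - + 0) * c + + 0 * d + + 1 * b
    ordered = solve-∀
∑-insertions± n e p (x ∷ xs) z p≤n (x≤n ∷ xs≤n) = begin
  (∑[ w ← insertions X⁺ (x ∷ xs) ] δ (altDesB-go e p w) z)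
  + (∑[ w ← insertions X⁻ (x ∷ xs) ] δ (altDesB-go e p w) z)
    ≡⟨ cong₂ _+_ (∑-insertions-∷ X⁺ e p x xs z) (∑-insertions-∷ X⁻ e p x xs z) ⟩
  (front X⁺ + S X⁺) + (front X⁻ + S X⁻)
    ≡⟨ +-interchange (front X⁺) (S X⁺) (front X⁻) (S X⁻) ⟩
  (front X⁺ + front X⁻) + (S X⁺ + S X⁻)
    ≡⟨ cong₂ _+_ (δ-peak+valley n e p x xs z p≤n x≤n)
                 (∑-insertions± n (not e) x xs (z - + t) x≤n xs≤n) ⟩
  δ m z + δ m (z - + 2) + offspring m (length xs) (z - + t)
    ≡⟨ offspring-step (descends e p x) m (length xs) z ⟩
  offspring (altDesB-go e p (x ∷ xs)) (length (x ∷ xs)) z ∎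
  where
  open ≡-Reasoning
  X⁺ X⁻ : ℤ
  X⁺ = + suc n
  X⁻ = -[1+ n ]
  t = if descends e p x then 1 else 0
  m = altDesB-go (not e) x xs
  front S : ℤ → ℤ
  front X = δ (altDesB-go e p (X ∷ map -_ (x ∷ xs))) z
  S X = ∑[ w ← insertions X xs ] δ (altDesB-go (not e) x w) (z - + t)
  +-interchange : ∀ a b c d → (a + b) + (c + d) ≡ (a + c) + (b + d)
  +-interchange = solve-∀

offspring≡nextRow : ∀ m L z → offspring m L z ≡ nextRow L (δ m) z
offspring≡nextRow m L z = begin
  offspring m L z
    ≡⟨ rearrange (+ L) (+ m) z a₀ a₂ a₁ a₃ ⟩
  nextRow L (δ m) z - (+ m - z) * a₀ - (+ m - (z - + 2)) * a₂
                    + (+ m - (z + + 1)) * a₁ + (+ m - (z - + 1)) * a₃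
    ≡⟨ cong₂ _+_ (cong₂ _+_ (cong₂ _-_ (cong (λ s → nextRow L (δ m) z - s) (δ-vanish m z))
                                         (δ-vanish m (z - + 2)))
                             (δ-vanish m (z + + 1)))
                 (δ-vanish m (z - + 1)) ⟩
  nextRow L (δ m) z - + 0 - + 0 + + 0 + + 0
    ≡⟨ drop-zeros (nextRow L (δ m) z) ⟩
  nextRow L (δ m) z ∎
  where
  open ≡-Reasoning
  a₀ = δ m z
  a₂ = δ m (z - + 2)
  a₁ = δ m (z + + 1)
  a₃ = δ m (z - + 1)
  rearrange : ∀ L m z a₀ a₂ a₁ a₃ →
    (+ 1 + L - m) * a₀ + (L - m) * a₂ + m * a₁ + (+ 1 + m) * a₃
    ≡ (+ 1 + L - z) * (a₀ + a₂) + z * (a₁ + a₃) + a₁ + a₂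
      - (m - z) * a₀ - (m - (z - + 2)) * a₂ + (m - (z + + 1)) * a₁ + (m - (z - + 1)) * a₃
  rearrange = solve-∀
  drop-zeros : ∀ x → x - + 0 - + 0 + + 0 + + 0 ≡ x
  drop-zeros = solve-∀

Unique-resp-↭ : {xs ys : List A} → xs ↭ ys → Unique xs → Unique ys
Unique-resp-↭ {A = A} p = Permutationₛ.Unique-resp-↭ (≡.setoid A) (↭⇒↭ₛ p)

module _ (xs : List A) {v : A} {ys : List A} where

  Unique-middle⁻ : Unique (xs ++ v ∷ ys) → v ∉ xs ++ ys × Unique (xs ++ ys)
  Unique-middle⁻ u with Unique-resp-↭ (shift v xs ys) u
  ... | v∉ ∷ u′ = (λ v∈ → All.lookup v∉ v∈ refl) , u′

  Unique-middle⁺ : v ∉ xs ++ ys → Unique (xs ++ ys) → Unique (xs ++ v ∷ ys)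
  Unique-middle⁺ v∉ u =
    Unique-resp-↭ (↭-sym (shift v xs ys))
      (All.tabulate (λ y∈ v≡y → v∉ (≡.subst (_∈ xs ++ ys) (sym v≡y) y∈)) ∷ u)

∈-remove : ∀ xs {v ys} {y : A} → y ∈ xs ++ v ∷ ys → y ≢ v → y ∈ xs ++ ys
∈-remove xs {v} {ys} y∈ y≢v with ∈-resp-↭ (shift v xs ys) y∈
... | here y≡v  = contradiction y≡v y≢v
... | there y∈′ = y∈′

Unique⇒length≤ : ∀ {xs ys : List A} → Unique xs → All (_∈ ys) xs → length xs ≤ length ys
Unique⇒length≤ {xs = []}     []       []             = z≤n
Unique⇒length≤ {xs = x ∷ xs} (x∉ ∷ u) (x∈ys ∷ xs⊆ys) with ∈-∃++ x∈ys
... | as , bs , refl =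
  ≡.subst (length (x ∷ xs) ≤_) (sym (↭-length (shift x as bs)))
    (s≤s (Unique⇒length≤ u (All.zipWith (λ (x≢y , y∈) → ∈-remove as y∈ (x≢y ∘ sym))
                                         (x∉ , xs⊆ys))))

Unique-concatMap⁺ : ∀ (f : A → List B) {xs} → Unique xs → (∀ {x} → x ∈ xs → Unique (f x)) →
  (∀ {x x′ y} → x ∈ xs → x′ ∈ xs → y ∈ f x → y ∈ f x′ → x ≡ x′) → Unique (concatMap f xs)
Unique-concatMap⁺ f {[]}     []       _       _        = []
Unique-concatMap⁺ f {x ∷ xs} (x∉ ∷ u) unique≡ fibres≡ =
  Unique.++⁺ (unique≡ (here refl))
             (Unique-concatMap⁺ f u (unique≡ ∘ there) (λ x∈ x′∈ → fibres≡ (there x∈) (there x′∈)))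
             disjoint
  where
  disjoint : ∀ {y} → ¬ (y ∈ f x × y ∈ concatMap f xs)
  disjoint (y∈fx , y∈rest) with find (∈-concatMap⁻ f {xs = xs} y∈rest)
  ... | x′ , x′∈ , y∈fx′ = All.lookup x∉ x′∈ (fibres≡ (here refl) (there x′∈) y∈fx y∈fx′)

-- Signed permutations
Letter : ℕ → ℤ → Set
Letter n y = 0 < ∣ y ∣ × ∣ y ∣ ≤ n

∈-letters⁻ : ∀ {n y} → y ∈ letters n → Letter n y
∈-letters⁻ {n} y∈ with ∈-++⁻ (map (λ i → + suc i) (upTo n)) y∈
... | inj₁ y∈⁺ with _ , i∈ , refl ← ∈-map⁻ (λ i → + suc i) y∈⁺ = s≤s z≤n , ∈-upTo⁻ i∈
... | inj₂ y∈⁻ with _ , i∈ , refl ← ∈-map⁻ (λ i → -[1+ i ]) y∈⁻ = s≤s z≤n , ∈-upTo⁻ i∈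

∈-letters⁺ : ∀ {n} y → Letter n y → y ∈ letters n
∈-letters⁺ {n} (+ suc i)  (_ , i<n) = ∈-++⁺ˡ (∈-map⁺ (λ i → + suc i) (∈-upTo⁺ i<n))
∈-letters⁺ {n} -[1+ i ]   (_ , i<n) =
  ∈-++⁺ʳ (map (λ i → + suc i) (upTo n)) (∈-map⁺ (λ i → -[1+ i ]) (∈-upTo⁺ i<n))

letters-unique : ∀ n → Unique (letters n)
letters-unique n =
  Unique.++⁺ (Unique.map⁺ (λ { refl → refl }) (Unique.upTo⁺ n))
             (Unique.map⁺ (λ { refl → refl }) (Unique.upTo⁺ n))
             disjoint
  where
  disjoint : ∀ {y} → ¬ (y ∈ map (λ i → + suc i) (upTo n) × y ∈ map (λ i → -[1+ i ]) (upTo n))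
  disjoint (y∈⁺ , y∈⁻) with ∈-map⁻ _ y∈⁺ | ∈-map⁻ _ y∈⁻
  ... | _ , _ , refl | _ , _ , ()

module _ {A : Set} {L : List A} where

  ∈-words⁻ : ∀ m {w} → w ∈ words m L → length w ≡ m × All (_∈ L) w
  ∈-words⁻ zero    (here refl) = refl , []
  ∈-words⁻ (suc m) w∈ with find (∈-concatMap⁻ (λ x → map (x ∷_) (words m L)) {xs = L} w∈)
  ... | x , x∈L , w∈x∷ with _ , w′∈ , refl ← ∈-map⁻ (x ∷_) w∈x∷ with ∈-words⁻ m w′∈
  ... | refl , w′⊆L = refl , x∈L ∷ w′⊆L

  ∈-words⁺ : ∀ {w} → All (_∈ L) w → w ∈ words (length w) L
  ∈-words⁺ []           = here refl
  ∈-words⁺ {x ∷ w} (x∈L ∷ w⊆L) =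
    ∈-concatMap⁺ (λ y → map (y ∷_) (words (length w) L)) (lose x∈L (∈-map⁺ (x ∷_) (∈-words⁺ w⊆L)))

  words-unique : ∀ m → Unique L → Unique (words m L)
  words-unique zero    _ = [] ∷ []
  words-unique (suc m) u =
    Unique-concatMap⁺ (λ x → map (x ∷_) (words m L)) u
      (λ _ → Unique.map⁺ (λ { refl → refl }) (words-unique m u))
      (λ _ _ y∈ y∈′ → same-head (∈-map⁻ _ y∈) (∈-map⁻ _ y∈′))
    where
    same-head : ∀ {x x′ : A} {y} → ∃ (λ w → w ∈ words m L × y ≡ x ∷ w) →
                ∃ (λ w → w ∈ words m L × y ≡ x′ ∷ w) → x ≡ x′
    same-head (_ , _ , refl) (_ , _ , refl) = refl

SignedPerm : ℕ → List ℤ → Set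
SignedPerm n σ = length σ ≡ n × All (Letter n) σ × IsSignedPerm σ

∈-signedPerms⁻ : ∀ {n σ} → σ ∈ signedPerms n → SignedPerm n σ
∈-signedPerms⁻ {n} σ∈ with σ∈words , perm ← ∈-filter⁻ isSignedPerm? {xs = words n (letters n)} σ∈
  with ∈-words⁻ n σ∈words
... | length≡ , σ⊆letters = length≡ , All.map ∈-letters⁻ σ⊆letters , perm

∈-signedPerms⁺ : ∀ {n σ} → SignedPerm n σ → σ ∈ signedPerms n
∈-signedPerms⁺ (refl , letters , perm) =
  ∈-filter⁺ isSignedPerm? (∈-words⁺ (All.tabulate (λ {y} y∈ → ∈-letters⁺ y (All.lookup letters y∈))))
            perm

signedPerms-unique : ∀ n → Unique (signedPerms n)
signedPerms-unique n = Unique.filter⁺ isSignedPerm? (words-unique n (letters-unique n))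

∈-signedPerms⇒bounded : ∀ {n σ} → σ ∈ signedPerms n → All (λ y → ∣ y ∣ ≤ n) σ
∈-signedPerms⇒bounded σ∈ = All.map proj₂ (proj₁ (proj₂ (∈-signedPerms⁻ σ∈)))

Letter-∣∣ : ∀ {n} y y′ → ∣ y ∣ ≡ ∣ y′ ∣ → Letter n y → Letter n y′
Letter-∣∣ {n} _ _ eq = ≡.subst (λ k → 0 < k × k ≤ n) eq

Letter-weaken : ∀ {n} y → Letter n y → Letter (suc n) y
Letter-weaken _ (0<y , y≤n) = 0<y , ℕ.m≤n⇒m≤1+n y≤n

-- Extensions enumerate the signed permutations of [n+1]
children : ℕ → List (List ℤ)
children n = concatMap (extensions n) (signedPerms n)

map-neg-involutive : ∀ xs → map -_ (map -_ xs) ≡ xs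
map-neg-involutive []       = refl
map-neg-involutive (x ∷ xs) = cong₂ _∷_ (ℤ.neg-involutive x) (map-neg-involutive xs)

∈-insertions⁻ : ∀ {X} σ {w} → w ∈ insertions X σ → ∃₂ λ a b → σ ≡ a ++ b × w ≡ a ++ X ∷ map -_ b
∈-insertions⁻ []       (here refl) = [] , [] , refl , refl
∈-insertions⁻ (x ∷ xs) (here refl) = [] , x ∷ xs , refl , refl
∈-insertions⁻ (x ∷ xs) (there w∈) with _ , w′∈ , refl ← ∈-map⁻ (x ∷_) w∈
  with a , b , refl , refl ← ∈-insertions⁻ xs w′∈ = x ∷ a , b , refl , refl

∈-insertions⁺ : ∀ {X} a b → a ++ X ∷ map -_ b ∈ insertions X (a ++ b)
∈-insertions⁺ []      []      = here refl
∈-insertions⁺ []      (_ ∷ _) = here refl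
∈-insertions⁺ (x ∷ a) b       = there (∈-map⁺ (x ∷_) (∈-insertions⁺ a b))

insertions-unique : ∀ {X} σ → X ∉ σ → Unique (insertions X σ)
insertions-unique []       _  = [] ∷ []
insertions-unique {X} (x ∷ xs) X∉ =
  All.tabulate (λ w∈ → head-differs (∈-map⁻ (x ∷_) w∈)) ∷
  Unique.map⁺ (λ { refl → refl }) (insertions-unique xs (X∉ ∘ there))
  where
  head-differs : ∀ {w} → ∃ (λ w′ → w′ ∈ insertions X xs × w ≡ x ∷ w′) → X ∷ map -_ (x ∷ xs) ≢ w
  head-differs (_ , _ , refl) refl = X∉ (here refl)

uninsert : ℕ → List ℤ → ℤ × List ℤ
uninsert N []       = + 0 , []
uninsert N (x ∷ xs) with ∣ x ∣ ℕ.≟ N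
... | yes _ = x , map -_ xs
... | no _  = Product.map₂ (x ∷_) (uninsert N xs)

uninsert-insert : ∀ {N X} a b → ∣ X ∣ ≡ N → All (λ y → ∣ y ∣ ≢ N) a →
                uninsert N (a ++ X ∷ map -_ b) ≡ (X , a ++ b)
uninsert-insert {N} {X} [] b X≡N [] with ∣ X ∣ ℕ.≟ N
... | yes _   = cong (X ,_) (map-neg-involutive b)
... | no X≢N  = contradiction X≡N X≢N
uninsert-insert {N} (x ∷ a) b X≡N (x≢N ∷ a≢N) with ∣ x ∣ ℕ.≟ N
... | yes x≡N = contradiction x≡N x≢N
... | no _    = cong (Product.map₂ (x ∷_)) (uninsert-insert a b X≡N a≢N)

uninsert-∈-insertions : ∀ {n X} σ {w} → ∣ X ∣ ≡ suc n → All (λ y → ∣ y ∣ ≤ n) σ →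
                      w ∈ insertions X σ → uninsert (suc n) w ≡ (X , σ)
uninsert-∈-insertions σ X≡ σ≤n w∈ with a , b , refl , refl ← ∈-insertions⁻ σ w∈ =
  uninsert-insert a b X≡ (All.map (λ y≤n → ℕ.<⇒≢ (s≤s y≤n)) (All.++⁻ˡ a σ≤n))

uninsert-∈-extensions : ∀ {n} σ {w} → All (λ y → ∣ y ∣ ≤ n) σ →
                        w ∈ extensions n σ → proj₂ (uninsert (suc n) w) ≡ σ
uninsert-∈-extensions {n} σ σ≤n w∈ with ∈-++⁻ (insertions (+ suc n) σ) w∈
... | inj₁ w∈⁺ = cong proj₂ (uninsert-∈-insertions σ refl σ≤n w∈⁺)
... | inj₂ w∈⁻ = cong proj₂ (uninsert-∈-insertions σ refl σ≤n w∈⁻)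

extensions-unique : ∀ {n} σ → All (λ y → ∣ y ∣ ≤ n) σ → Unique (extensions n σ)
extensions-unique {n} σ σ≤n =
  Unique.++⁺ (insertions-unique σ (top∉ (+ suc n) refl))
             (insertions-unique σ (top∉ -[1+ n ] refl))
             disjoint
  where
  top∉ : ∀ X → ∣ X ∣ ≡ suc n → X ∉ σ
  top∉ X X≡ X∈ = ℕ.<-irrefl refl (≡.subst (_≤ n) X≡ (All.lookup σ≤n X∈))
  disjoint : ∀ {w} → ¬ (w ∈ insertions (+ suc n) σ × w ∈ insertions -[1+ n ] σ)
  disjoint (w∈⁺ , w∈⁻)
    with () ← ≡.trans (sym (cong proj₁ (uninsert-∈-insertions σ refl σ≤n w∈⁺)))
                      (cong proj₁ (uninsert-∈-insertions σ refl σ≤n w∈⁻))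

children-unique : ∀ n → Unique (children n)
children-unique n =
  Unique-concatMap⁺ (extensions n) (signedPerms-unique n)
    (λ σ∈ → extensions-unique _ (∈-signedPerms⇒bounded σ∈))
    (λ σ∈ σ′∈ w∈ w∈′ → ≡.trans (sym (uninsert-∈-extensions _ (∈-signedPerms⇒bounded σ∈) w∈))
                                 (uninsert-∈-extensions _ (∈-signedPerms⇒bounded σ′∈) w∈′))

length-insert : ∀ X a b → length (a ++ X ∷ map -_ b) ≡ suc (length (a ++ b))
length-insert X []      b = cong suc (List.length-map -_ b)
length-insert X (x ∷ a) b = cong suc (length-insert X a b)

abs-insert : ∀ X a b → map ∣_∣ (a ++ X ∷ map -_ b) ≡ map ∣_∣ a ++ ∣ X ∣ ∷ map ∣_∣ b
abs-insert X []      b = cong (∣ X ∣ ∷_) (≡.trans (sym (List.map-∘ b)) (List.map-cong ℤ.∣-i∣≡∣i∣ b))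
abs-insert X (x ∷ a) b = cong (∣ x ∣ ∷_) (abs-insert X a b)

insertion-signedPerm : ∀ {n X} a b → ∣ X ∣ ≡ suc n →
                       SignedPerm n (a ++ b) → SignedPerm (suc n) (a ++ X ∷ map -_ b)
insertion-signedPerm {n} {X} a b X≡ (length≡ , letters , perm) =
  ≡.trans (length-insert X a b) (cong suc length≡) ,
  All.tabulate letter ,
  ≡.subst Unique (sym (abs-insert X a b))
    (Unique-middle⁺ (map ∣_∣ a) X∉ (≡.subst Unique (List.map-++ ∣_∣ a b) perm))
  where
  letter : ∀ {y} → y ∈ a ++ X ∷ map -_ b → Letter (suc n) y
  letter {y} y∈ with ∈-++⁻ a y∈
  ... | inj₁ y∈a          = Letter-weaken y (All.lookup letters (∈-++⁺ˡ y∈a))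
  ... | inj₂ (here refl)  = Letter-∣∣ (+ suc n) X (sym X≡) (s≤s z≤n , ℕ.≤-refl)
  ... | inj₂ (there y∈-b) with y′ , y′∈b , refl ← ∈-map⁻ -_ y∈-b =
    Letter-weaken (- y′)
      (Letter-∣∣ y′ (- y′) (sym (ℤ.∣-i∣≡∣i∣ y′)) (All.lookup letters (∈-++⁺ʳ a y′∈b)))
  X∉ : ∣ X ∣ ∉ map ∣_∣ a ++ map ∣_∣ b
  X∉ X∈ with y , y∈ , X≡y ← ∈-map⁻ ∣_∣ (≡.subst (∣ X ∣ ∈_) (sym (List.map-++ ∣_∣ a b)) X∈) =
    ℕ.<-irrefl refl (≡.subst (_≤ n) (≡.trans (sym X≡y) X≡) (proj₂ (All.lookup letters y∈)))

deletion-signedPerm : ∀ {n X} a b → ∣ X ∣ ≡ suc n →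
                      SignedPerm (suc n) (a ++ X ∷ map -_ b) → SignedPerm n (a ++ b)
deletion-signedPerm {n} {X} a b X≡ (length≡ , letters , perm) =
  ℕ.suc-injective (≡.trans (sym (length-insert X a b)) length≡) ,
  All.tabulate letter ,
  ≡.subst Unique (sym (List.map-++ ∣_∣ a b)) (proj₂ split)
  where
  split : ∣ X ∣ ∉ map ∣_∣ a ++ map ∣_∣ b × Unique (map ∣_∣ a ++ map ∣_∣ b)
  split = Unique-middle⁻ (map ∣_∣ a) (≡.subst Unique (abs-insert X a b) perm)
  letter′ : ∀ {y} → y ∈ a ++ b → Letter (suc n) y
  letter′ {y} y∈ with ∈-++⁻ a y∈
  ... | inj₁ y∈a = All.lookup letters (∈-++⁺ˡ y∈a)
  ... | inj₂ y∈b = Letter-∣∣ (- y) y (ℤ.∣-i∣≡∣i∣ y)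
                     (All.lookup letters (∈-++⁺ʳ a (there (∈-map⁺ -_ y∈b))))
  letter : ∀ {y} → y ∈ a ++ b → Letter n y
  letter {y} y∈ with 0<y , y≤1+n ← letter′ y∈ =
    0<y , ℕ.≤-pred (ℕ.≤∧≢⇒< y≤1+n (λ y≡ → proj₁ split
            (≡.subst (_∈ map ∣_∣ a ++ map ∣_∣ b) (≡.trans y≡ (sym X≡))
              (≡.subst (∣ y ∣ ∈_) (List.map-++ ∣_∣ a b) (∈-map⁺ ∣_∣ y∈)))))

∈-applyUpTo-suc : ∀ {n k} → 0 < k → k ≤ n → k ∈ applyUpTo suc n
∈-applyUpTo-suc {k = suc i} _ i<n = ∈-applyUpTo⁺ suc i<n

∃-top-letter : ∀ {n w} → SignedPerm (suc n) w → ∃ λ X → X ∈ w × ∣ X ∣ ≡ suc n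
∃-top-letter {n} {w} (length≡ , letters , perm) with any? (λ x → ∣ x ∣ ℕ.≟ suc n) w
... | yes top∈ = find top∈
... | no  top∉ = contradiction (Unique⇒length≤ perm (All.map⁺ (All.tabulate below-top))) too-long
  where
  below-top : ∀ {x} → x ∈ w → ∣ x ∣ ∈ applyUpTo suc n
  below-top x∈ with 0<x , x≤1+n ← All.lookup letters x∈ =
    ∈-applyUpTo-suc 0<x (ℕ.≤-pred (ℕ.≤∧≢⇒< x≤1+n (λ x≡ → top∉ (lose x∈ x≡))))
  too-long : ¬ length (map ∣_∣ w) ≤ length (applyUpTo suc n)
  too-long w≤n = ℕ.<-irrefl refl
    (≡.subst₂ _≤_ (≡.trans (List.length-map ∣_∣ w) length≡) (List.length-applyUpTo suc n) w≤n)

insertions⊆signedPerms : ∀ {n X σ w} → ∣ X ∣ ≡ suc n → σ ∈ signedPerms n →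
                         w ∈ insertions X σ → w ∈ signedPerms (suc n)
insertions⊆signedPerms {σ = σ} X≡ σ∈ w∈ with a , b , refl , refl ← ∈-insertions⁻ σ w∈ =
  ∈-signedPerms⁺ (insertion-signedPerm a b X≡ (∈-signedPerms⁻ σ∈))

∈-children⁻ : ∀ {n w} → w ∈ children n → w ∈ signedPerms (suc n)
∈-children⁻ {n} w∈ with σ , σ∈ , w∈ext ← find (∈-concatMap⁻ (extensions n) {xs = signedPerms n} w∈)
  with ∈-++⁻ (insertions (+ suc n) σ) w∈ext
... | inj₁ w∈⁺ = insertions⊆signedPerms refl σ∈ w∈⁺
... | inj₂ w∈⁻ = insertions⊆signedPerms refl σ∈ w∈⁻

∈-children⁺ : ∀ {n w} → w ∈ signedPerms (suc n) → w ∈ children n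
∈-children⁺ {n} w∈ with X , X∈ , X≡ ← ∃-top-letter (∈-signedPerms⁻ w∈)
  with a , b , refl ← ∈-∃++ X∈ =
  ∈-concatMap⁺ (extensions n) (lose σ∈ (≡.subst (_∈ extensions n σ) (sym w≡) (∈-extensions X X≡)))
  where
  σ = a ++ map -_ b
  w≡ : a ++ X ∷ b ≡ a ++ X ∷ map -_ (map -_ b)
  w≡ = cong (λ c → a ++ X ∷ c) (sym (map-neg-involutive b))
  σ∈ : σ ∈ signedPerms n
  σ∈ = ∈-signedPerms⁺ (deletion-signedPerm a (map -_ b) X≡
                         (≡.subst (SignedPerm (suc n)) w≡ (∈-signedPerms⁻ w∈)))
  ∈-extensions : ∀ X → ∣ X ∣ ≡ suc n → a ++ X ∷ map -_ (map -_ b) ∈ extensions n σ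
  ∈-extensions (+ _)     refl = ∈-++⁺ˡ (∈-insertions⁺ a (map -_ b))
  ∈-extensions -[1+ _ ]  refl = ∈-++⁺ʳ (insertions (+ suc n) σ) (∈-insertions⁺ a (map -_ b))

children↭signedPerms : ∀ n → children n ↭ signedPerms (suc n)
children↭signedPerms n =
  ∼bag⇒↭ (unique∧set⇒bag (children-unique n) (signedPerms-unique (suc n))
                          (mk⇔ (∈-children⁻ {n}) (∈-children⁺ {n})))

∑-extensions : ∀ {n σ} → σ ∈ signedPerms n → ∀ z →
  ∑[ w ← extensions n σ ] δ (altDesB w) z ≡ nextRow n (δ (altDesB σ)) z
∑-extensions {n} {σ} σ∈ z = begin
  ∑[ w ← extensions n σ ] δ (altDesB w) z
    ≡⟨ ∑-++ (insertions (+ suc n) σ) (insertions -[1+ n ] σ) _ ⟩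
  (∑[ w ← insertions (+ suc n) σ ] δ (altDesB w) z)
  + (∑[ w ← insertions -[1+ n ] σ ] δ (altDesB w) z)
    ≡⟨ ∑-insertions± n true (+ 0) σ z z≤n (∈-signedPerms⇒bounded σ∈) ⟩
  offspring (altDesB σ) (length σ) z
    ≡⟨ cong (λ L → offspring (altDesB σ) L z) (proj₁ (∈-signedPerms⁻ σ∈)) ⟩
  offspring (altDesB σ) n z
    ≡⟨ offspring≡nextRow (altDesB σ) n z ⟩
  nextRow n (δ (altDesB σ)) z ∎
  where open ≡-Reasoning

proposition3p2 : (n : ℕ) → 1 ≤ n → (k : ℕ) →
    BhatZ (suc n) (+ k) ≡
      ((+ (suc n) - + k) * (BhatZ n (+ k) + BhatZ n (+ k - + 2)))
      + (+ k * (BhatZ n (+ k + + 1) + BhatZ n (+ k - + 1)))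
      + BhatZ n (+ k + + 1) + BhatZ n (+ k - + 2)
-- The recurrence holds for n = 0 as well.
proposition3p2 n _ k = begin
  BhatZ (suc n) (+ k)
    ≡⟨ BhatZ≡∑δ (suc n) (+ k) ⟩
  ∑[ w ← signedPerms (suc n) ] δ (altDesB w) (+ k)
    ≡⟨ ∑-↭ _ (↭-sym (children↭signedPerms n)) ⟩
  ∑[ w ← children n ] δ (altDesB w) (+ k)
    ≡⟨ ∑-concatMap (extensions n) (signedPerms n) _ ⟩
  ∑[ σ ← signedPerms n ] (∑[ w ← extensions n σ ] δ (altDesB w) (+ k))
    ≡⟨ ∑-cong (signedPerms n) (λ σ∈ → ∑-extensions σ∈ (+ k)) ⟩
  ∑[ σ ← signedPerms n ] nextRow n (δ (altDesB σ)) (+ k)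
    ≡⟨ ∑-nextRow n (signedPerms n) (λ σ → δ (altDesB σ)) (+ k) ⟩
  nextRow n (λ z → ∑[ σ ← signedPerms n ] δ (altDesB σ) z) (+ k)
    ≡⟨ nextRow-cong n (λ z → sym (BhatZ≡∑δ n z)) (+ k) ⟩
  nextRow n (BhatZ n) (+ k) ∎
  where open ≡-Reasoning
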